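{- Let $\mathbf{A}=\langle A,\cdot,\lnot\rangle$ be an a-involutive left-normal band. The following are equivalent: (1) $\mathbf{A}\vDash x\cdot y\approx x\cdot\lnot y$; (2) $\mathbf{A}\vDash x\cdot\lnot x\approx x$; (3) $\mathbf{A}/\mathcal{D}\in\mathcal{RISL}$.
   Context: A band is an idempotent semigroup; it is left-normal if it satisfies $xyz\approx xzy$. An a-involutive band is an algebra $\langle A,\cdot,\lnot\rangle$ where $\langle A,\cdot\rangle$ is a band, $\lnot\lnot x\approx x$, and $\lnot(x\cdot y)\approx \lnot x\cdot\lnot y$. Green's relation $\mathcal{D}$ on a band is defined by $a\,\mathcal{D}\,b$ iff $aba=a$ and $bab=b$; for an a-involutive left-normal band, $\mathcal{D}$ is a congruence of $\langle A,\cdot,\lnot\rangle$ and $\mathbf{A}/\mathcal{D}$ is an involutive semilattice (a semilattice $\langle I,\lor\rangle$ with an operation $\lnot$ satisfying $\lnot\lnot x\approx x$ and $\lnot(x\lor y)\approx\lnot x\lor\lnot y$). $\mathcal{RISL}$ is the variety of involutive semilattices satisfying $x\approx\lnot x$. -}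

module Defs where

open import Level using (Level; suc; _⊔_)
open import Data.Product using (_×_; _,_)
open import Relation.Binary.PropositionalEquality using (_≡_)
open import Relation.Binary.Core using (Rel)

record AInvLNBand (a : Level) : Set (suc a) where
  infixl 7 _·_
  field
    Carrier : Set a
    _·_     : Carrier → Carrier → Carrier
    ¬_      : Carrier → Carrier
    assoc   : ∀ x y z → (x · y) · z ≡ x · (y · z)
    idem    : ∀ x → x · x ≡ x
    leftNormal : ∀ x y z → x · y · z ≡ x · z · y
    invol   : ∀ x → ¬ (¬ x) ≡ x
    ¬-hom   : ∀ x y → ¬ (x · y) ≡ (¬ x) · (¬ y)

  _D_ : Rel Carrier a
  x D y = (x · y · x ≡ x) × (y · x · y ≡ y)

-- An involutive semilattice over a carrier with an equivalence _≈_
-- (setoid presentation; used to present quotients such as A/D).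
record IsInvolutiveSemilattice {a ℓ : Level} (I : Set a) (_≈_ : Rel I ℓ)
                               (_∨_ : I → I → I) (¬_ : I → I) : Set (a ⊔ ℓ) where
  field
    refl′  : ∀ {x} → x ≈ x
    sym′   : ∀ {x y} → x ≈ y → y ≈ x
    trans′ : ∀ {x y z} → x ≈ y → y ≈ z → x ≈ z
    ∨-cong : ∀ {x x′ y y′} → x ≈ x′ → y ≈ y′ → (x ∨ y) ≈ (x′ ∨ y′)
    ¬-cong : ∀ {x y} → x ≈ y → (¬ x) ≈ (¬ y)
    ∨-assoc : ∀ x y z → ((x ∨ y) ∨ z) ≈ (x ∨ (y ∨ z))
    ∨-comm  : ∀ x y → (x ∨ y) ≈ (y ∨ x)
    ∨-idem  : ∀ x → (x ∨ x) ≈ x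
    ¬-invol : ∀ x → (¬ (¬ x)) ≈ x
    ¬-hom   : ∀ x y → (¬ (x ∨ y)) ≈ ((¬ x) ∨ (¬ y))

InRISL : {a ℓ : Level} (I : Set a) (_≈_ : Rel I ℓ)
         (_∨_ : I → I → I) (¬_ : I → I) → Set (a ⊔ ℓ)
InRISL I _≈_ _∨_ ¬_ = IsInvolutiveSemilattice I _≈_ _∨_ ¬_ × (∀ x → x ≈ (¬ x))

module _ {a : Level} (A : AInvLNBand a) where
  open AInvLNBand A

  Cond1 : Set a
  Cond1 = ∀ x y → x · y ≡ x · (¬ y)

  Cond2 : Set a
  Cond2 = ∀ x → x · (¬ x) ≡ x

  -- Condition (3): A/D ∈ RISL, the quotient A/D presented as the setoid
  -- (Carrier, D) with the induced operations · and ¬.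
  Cond3 : Set a
  Cond3 = InRISL Carrier _D_ _·_ ¬_

-- Modulo D, a left-normal band is a semilattice, and ¬ induces an involution
-- on it; so A/D is always an involutive semilattice and (3) only adds x D ¬x.
-- In a left-normal band x D y amounts to x·y = x and y·x = y, so (3) is (2)
-- together with ¬x·x = ¬x, the image of (2) under ¬. Finally (1) and (2) are
-- interderivable: (2) is (1) at y = ¬x, and conversely
-- x·y = x·y·¬y = x·¬y·y = x·¬y·¬¬y = x·¬y using left normality.
module Submission where

open import Defs
open import Level using (Level)
open import Data.Product using (_×_; _,_; proj₂)
open import Function.Bundles using (_⇔_; mk⇔)
open import Relation.Binary.PropositionalEquality

module AInvLNBandProperties {a : Level} (A : AInvLNBand a) where
  open AInvLNBand A
  open ≡-Reasoning

  x·y·x≡x·y : ∀ x y → x · y · x ≡ x · y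
  x·y·x≡x·y x y = trans (leftNormal x y x) (cong (_· y) (idem x))

  absorb⇒D : ∀ {x y} → x · y ≡ x → y · x ≡ y → x D y
  absorb⇒D {x} {y} xy≡x yx≡y = trans (x·y·x≡x·y x y) xy≡x , trans (x·y·x≡x·y y x) yx≡y

  D⇒absorbˡ : ∀ {x y} → x D y → x · y ≡ x
  D⇒absorbˡ {x} {y} (xyx≡x , _) = trans (sym (x·y·x≡x·y x y)) xyx≡x

  D⇒absorbʳ : ∀ {x y} → x D y → y · x ≡ y
  D⇒absorbʳ {x} {y} (_ , yxy≡y) = trans (sym (x·y·x≡x·y y x)) yxy≡y

  ≡⇒D : ∀ {x y} → x ≡ y → x D y
  ≡⇒D {x} refl = absorb⇒D (idem x) (idem x)

  D-sym : ∀ {x y} → x D y → y D x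
  D-sym (xyx≡x , yxy≡y) = yxy≡y , xyx≡x

  D-trans : ∀ {x y z} → x D y → y D z → x D z
  D-trans {x} {y} {z} x~y y~z = absorb⇒D
    (begin
      x · z       ≡⟨ cong (_· z) (sym (D⇒absorbˡ x~y)) ⟩
      x · y · z   ≡⟨ assoc x y z ⟩
      x · (y · z) ≡⟨ cong (x ·_) (D⇒absorbˡ y~z) ⟩
      x · y       ≡⟨ D⇒absorbˡ x~y ⟩
      x           ∎)
    (begin
      z · x       ≡⟨ cong (_· x) (sym (D⇒absorbʳ y~z)) ⟩
      z · y · x   ≡⟨ assoc z y x ⟩
      z · (y · x) ≡⟨ cong (z ·_) (D⇒absorbʳ x~y) ⟩
      z · y       ≡⟨ D⇒absorbʳ y~z ⟩
      z           ∎)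

  ·-absorb-cong : ∀ {x x′ y y′} → x · x′ ≡ x → y · y′ ≡ y → x · y · (x′ · y′) ≡ x · y
  ·-absorb-cong {x} {x′} {y} {y′} xx′≡x yy′≡y = begin
    x · y · (x′ · y′) ≡⟨ sym (assoc (x · y) x′ y′) ⟩
    x · y · x′ · y′   ≡⟨ cong (_· y′) (leftNormal x y x′) ⟩
    x · x′ · y · y′   ≡⟨ cong (λ t → t · y · y′) xx′≡x ⟩
    x · y · y′        ≡⟨ assoc x y y′ ⟩
    x · (y · y′)      ≡⟨ cong (x ·_) yy′≡y ⟩
    x · y             ∎

  ·-cong-D : ∀ {x x′ y y′} → x D x′ → y D y′ → (x · y) D (x′ · y′)
  ·-cong-D x~x′ y~y′ = absorb⇒D
    (·-absorb-cong (D⇒absorbˡ x~x′) (D⇒absorbˡ y~y′))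
    (·-absorb-cong (D⇒absorbʳ x~x′) (D⇒absorbʳ y~y′))

  ·-comm-D : ∀ x y → (x · y) D (y · x)
  ·-comm-D x y = absorb⇒D (x·y·y·x≡x·y x y) (x·y·y·x≡x·y y x)
    where
    x·y·y·x≡x·y : ∀ x y → x · y · (y · x) ≡ x · y
    x·y·y·x≡x·y x y = begin
      x · y · (y · x) ≡⟨ sym (assoc (x · y) y x) ⟩
      x · y · y · x   ≡⟨ cong (_· x) (assoc x y y) ⟩
      x · (y · y) · x ≡⟨ cong (λ t → x · t · x) (idem y) ⟩
      x · y · x       ≡⟨ x·y·x≡x·y x y ⟩
      x · y           ∎

  ¬-cong-D : ∀ {x y} → x D y → (¬ x) D (¬ y)
  ¬-cong-D {x} {y} x~y = absorb⇒D
    (trans (sym (¬-hom x y)) (cong ¬_ (D⇒absorbˡ x~y)))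
    (trans (sym (¬-hom y x)) (cong ¬_ (D⇒absorbʳ x~y)))

  D-isInvolutiveSemilattice : IsInvolutiveSemilattice Carrier _D_ _·_ ¬_
  D-isInvolutiveSemilattice = record
    { refl′   = ≡⇒D refl
    ; sym′    = D-sym
    ; trans′  = D-trans
    ; ∨-cong  = ·-cong-D
    ; ¬-cong  = ¬-cong-D
    ; ∨-assoc = λ x y z → ≡⇒D (assoc x y z)
    ; ∨-comm  = ·-comm-D
    ; ∨-idem  = λ x → ≡⇒D (idem x)
    ; ¬-invol = λ x → ≡⇒D (invol x)
    ; ¬-hom   = λ x y → ≡⇒D (¬-hom x y)
    }

  cond1⇒cond2 : Cond1 A → Cond2 A
  cond1⇒cond2 cond1 x = begin
    x · ¬ x     ≡⟨ cond1 x (¬ x) ⟩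
    x · ¬ (¬ x) ≡⟨ cong (x ·_) (invol x) ⟩
    x · x       ≡⟨ idem x ⟩
    x           ∎

  cond2⇒cond1 : Cond2 A → Cond1 A
  cond2⇒cond1 cond2 x y = begin
    x · y               ≡⟨ cong (x ·_) (sym (cond2 y)) ⟩
    x · (y · ¬ y)       ≡⟨ sym (assoc x y (¬ y)) ⟩
    x · y · ¬ y         ≡⟨ leftNormal x y (¬ y) ⟩
    x · ¬ y · y         ≡⟨ cong (x · ¬ y ·_) (sym (invol y)) ⟩
    x · ¬ y · ¬ (¬ y)   ≡⟨ assoc x (¬ y) (¬ (¬ y)) ⟩
    x · (¬ y · ¬ (¬ y)) ≡⟨ cong (x ·_) (cond2 (¬ y)) ⟩
    x · ¬ y             ∎

  cond2⇒D¬ : Cond2 A → ∀ x → x D (¬ x)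
  cond2⇒D¬ cond2 x = absorb⇒D (cond2 x) (begin
    ¬ x · x       ≡⟨ cong (¬ x ·_) (sym (invol x)) ⟩
    ¬ x · ¬ (¬ x) ≡⟨ sym (¬-hom x (¬ x)) ⟩
    ¬ (x · ¬ x)   ≡⟨ cong ¬_ (cond2 x) ⟩
    ¬ x           ∎)

  cond2⇒cond3 : Cond2 A → Cond3 A
  cond2⇒cond3 cond2 = D-isInvolutiveSemilattice , cond2⇒D¬ cond2

  cond3⇒cond2 : Cond3 A → Cond2 A
  cond3⇒cond2 cond3 x = D⇒absorbˡ (proj₂ cond3 x)

lemma3p5 : {a : Level} (A : AInvLNBand a) →
    ((Cond1 A ⇔ Cond2 A) × (Cond2 A ⇔ Cond3 A))
lemma3p5 A = mk⇔ cond1⇒cond2 cond2⇒cond1 , mk⇔ cond2⇒cond3 cond3⇒cond2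
  where open AInvLNBandProperties A
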